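{- Let $d\ge2$ and $k\in[d-1]$. There exist subsets $A_1,\dots,A_{d+k}$ of $\mathbb{R}^d$ with $\dim\operatorname{lpos}A_i>k$ for all $i\in[d+k]$, such that $\dim\operatorname{lpos}R\le k$ for every rainbow sub-selection $R$ from $A_1,\dots,A_{d+k}$.
   Context: $[n]=\{1,\dots,n\}$. $\operatorname{pos}A$ is the set of finite nonnegative linear combinations of elements of $A$, and $\operatorname{lpos}A=\operatorname{pos}A\cap(-\operatorname{pos}A)$ is its lineality space. A rainbow sub-selection from sets $A_1,\dots,A_N$ is a set obtained by choosing at most one element from each $A_j$ (no bound on its size is imposed here).
   Formalization: The sets $A_1,\dots,A_{d+k}$ are taken in ℚ^d instead of $\mathbb{R}^d$, with nonnegative combinations, lineality spaces and dimensions likewise taken over ℚ. -}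

module Defs where

open import Data.Nat using (ℕ; suc)
open import Data.Fin using (Fin)
open import Data.Rational using (ℚ; 0ℚ; _+_; _*_; -_; _≤_)
open import Data.Product using (Σ; ∃; _×_; _,_)
open import Data.List using (List; []; _∷_)
open import Data.List.Relation.Unary.All using (All)
open import Data.Maybe using (Maybe; just)
open import Relation.Binary.PropositionalEquality using (_≡_)
open import Relation.Nullary using (¬_)

Pt : ℕ → Set
Pt d = Fin d → ℚ

PtSet : ℕ → Set₁
PtSet d = Pt d → Set

zeroPt : ∀ {d} → Pt d
zeroPt _ = 0ℚ

_⊕_ : ∀ {d} → Pt d → Pt d → Pt d
(u ⊕ v) i = u i + v i

_⊙_ : ∀ {d} → ℚ → Pt d → Pt d
(c ⊙ v) i = c * v i

negPt : ∀ {d} → Pt d → Pt d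
negPt v i = - v i

_≈_ : ∀ {d} → Pt d → Pt d → Set
u ≈ v = ∀ i → u i ≡ v i

lincomb : ∀ {d} → List (ℚ × Pt d) → Pt d
lincomb []             = zeroPt
lincomb ((c , a) ∷ cs) = (c ⊙ a) ⊕ lincomb cs

pos : ∀ {d} → PtSet d → PtSet d
pos {d} A v = Σ (List (ℚ × Pt d)) λ cs →
  All (λ ca → (0ℚ ≤ Data.Product.proj₁ ca) × A (Data.Product.proj₂ ca)) cs
  × (lincomb cs ≈ v)

lpos : ∀ {d} → PtSet d → PtSet d
lpos A v = pos A v × pos A (negPt v)

fsum : ∀ {d m} → (Fin m → ℚ) → (Fin m → Pt d) → Pt d
fsum {m = ℕ.zero} c u = zeroPt
fsum {m = suc m} c u = (c Fin.zero ⊙ u Fin.zero) ⊕ fsum (λ j → c (Fin.suc j)) (λ j → u (Fin.suc j))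

LinIndep : ∀ {d m} → (Fin m → Pt d) → Set
LinIndep {m = m} u = ∀ (c : Fin m → ℚ) → fsum c u ≈ zeroPt → ∀ j → c j ≡ 0ℚ

DimGe : ∀ {d} → PtSet d → ℕ → Set
DimGe {d} S m = Σ (Fin m → Pt d) λ u → (∀ j → S (u j)) × LinIndep u

DimGt : ∀ {d} → PtSet d → ℕ → Set
DimGt S k = DimGe S (suc k)

DimLe : ∀ {d} → PtSet d → ℕ → Set
DimLe S k = ¬ DimGe S (suc k)

-- A rainbow sub-selection from A_1..A_N is given by a partial choice:
-- f j = just v means v ∈ A_j is chosen, f j = nothing means nothing is chosen from A_j.
ValidChoice : ∀ {d N} → (Fin N → PtSet d) → (Fin N → Maybe (Pt d)) → Set
ValidChoice A f = ∀ j v → f j ≡ just v → A j v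

selSet : ∀ {d N} → (Fin N → Maybe (Pt d)) → PtSet d
selSet f v = ∃ λ j → f j ≡ just v

{-# OPTIONS --safe #-}
-- Split the coordinates of ℚᵈ into k+1 base coordinates and m = d-k-1 lift coordinates. Let
-- Cross = {±e_b} be the signed base unit vectors and, for a lift coordinate p,
-- Lifted p = {-e_p} ∪ {e_p + x : x ∈ Cross}. Take 2k+1 copies of Cross and one Lifted p for
-- every p, which makes d+k sets; the lineality space of each contains all e_b.
--
-- A linear functional that is nonnegative on R vanishes on lpos R. For a rainbow R, only the
-- point picked from Lifted p can be nonzero at coordinate p, so a sign multiple of e_p is
-- nonnegative on R and lpos R lies in {x_p = 0}. The 2k+2 signed directions ±e_b cannot all
-- be picked from the 2k+1 copies of Cross, so some σe_a is missed, and a functional -σe_a,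
-- corrected on the lift coordinates, is nonnegative on R; hence lpos R also lies in
-- {x_a = 0}, a coordinate subspace of dimension k.
module Submission where

open import Level using (0ℓ)
open import Algebra.Bundles using (CommutativeMonoid; CommutativeRing)
open import Data.Empty using (⊥-elim)
open import Data.Fin as Fin using (Fin; zero; suc; punchIn; punchOut; splitAt; _↑ˡ_; _↑ʳ_)
open import Data.Fin.Properties
  using (punchInᵢ≢i; punchIn-punchOut; all?; ¬∀⟶∃¬; ∀-cons; ↑ˡ-injective; ↑ʳ-injective;
         splitAt-↑ˡ; splitAt-↑ʳ; splitAt⁻¹-↑ˡ; splitAt⁻¹-↑ʳ; join-splitAt; <⇒notInjective; +↔⊎)
open import Data.List using (List; []; _∷_; _++_)
open import Data.List.Relation.Unary.All using (All; []; _∷_)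
import Data.List.Relation.Unary.All.Properties as All
open import Data.Maybe using (Maybe; just; maybe)
open import Data.Maybe.Properties using (just-injective)
open import Data.Nat as ℕ using (ℕ; zero; suc)
import Data.Nat.Properties as ℕ
open import Data.Product using (Σ; ∃; _×_; _,_; proj₁; proj₂)
open import Data.Rational
  using (ℚ; 0ℚ; 1ℚ; _+_; _*_; -_; _≤_; 1/_; NonZero; ≢-nonZero; nonNegative)
open import Data.Rational.Properties
open import Data.Sum using (_⊎_; inj₁; inj₂; [_,_]′)
open import Data.Vec.Functional using (Vector; removeAt; replicate; insertAt)
import Data.Vec.Functional as Vector
open import Data.Vec.Functional.Properties
  using (insertAt-lookup; insertAt-punchIn; lookup-++ˡ; lookup-++ʳ)
open import Function using (_∘_; id; Injective)
open import Function.Bundles using (_↔_; Inverse)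
open import Relation.Binary.PropositionalEquality
  using (_≡_; _≢_; refl; sym; trans; cong; cong₂; subst; cong-app; module ≡-Reasoning)
open import Relation.Nullary using (¬_; Dec; yes; no)
open import Relation.Nullary.Decidable.Core using (dec⇒maybe)
open import Tactic.RingSolver using (solve-∀)
import Tactic.RingSolver.Core.AlmostCommutativeRing as ACR

import Algebra.Properties.CommutativeMonoid.Sum as MonoidSum
import Algebra.Properties.CommutativeSemigroup as CommutativeSemigroupProperties
import Algebra.Properties.Ring as RingProperties
import Algebra.Properties.Semiring.Sum as SemiringSum

private variable
  d m n : ℕ

module _ {c ℓ} (M : CommutativeMonoid c ℓ) where
  open CommutativeMonoid M using (Carrier; _≈_; _∙_; ε; ∙-congˡ; identityʳ; setoid)
  open MonoidSum M using (sum; sum-remove; sum-cong-≋; sum-replicate-zero)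
  open import Relation.Binary.Reasoning.Setoid setoid

  sum-vanishing-off : (t : Vector Carrier n) (i : Fin n) → (∀ j → j ≢ i → t j ≈ ε) → sum t ≈ t i
  sum-vanishing-off {suc n} t i t≈ε = begin
    sum t                     ≈⟨ sum-remove t ⟩
    t i ∙ sum (removeAt t i)  ≈⟨ ∙-congˡ (sum-cong-≋ (λ j → t≈ε _ (punchInᵢ≢i i j))) ⟩
    t i ∙ sum (replicate n ε) ≈⟨ ∙-congˡ (sum-replicate-zero n) ⟩
    t i ∙ ε                   ≈⟨ identityʳ (t i) ⟩
    t i                       ∎

open import Defs

open SemiringSum (CommutativeRing.semiring +-*-commutativeRing)
  using (sum; sum-cong-≗; sum-remove; sum-replicate-zero; ∑-distrib-+; *-distribˡ-sum; *-distribʳ-sum)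
open RingProperties +-*-ring using (-1*x≈-x; -‿involutive)
open CommutativeSemigroupProperties (CommutativeRing.*-commutativeSemigroup +-*-commutativeRing)
  using (x∙yz≈y∙xz)
open CommutativeSemigroupProperties ℕ.+-commutativeSemigroup using (xy∙z≈xz∙y)

ℚ-ring : ACR.AlmostCommutativeRing 0ℓ 0ℓ
ℚ-ring = ACR.fromCommutativeRing +-*-commutativeRing (λ x → dec⇒maybe (0ℚ ≟ x))

sum-*-zeros : (c a : Fin n → ℚ) → (∀ j → a j ≡ 0ℚ) → sum (λ j → c j * a j) ≡ 0ℚ
sum-*-zeros {n} c a a≡0 =
  trans (sum-cong-≗ {x = λ j → c j * a j} (λ j → trans (cong (c j *_) (a≡0 j)) (*-zeroʳ (c j))))
        (sum-replicate-zero n)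

*-nonNeg : ∀ {p q} → 0ℚ ≤ p → 0ℚ ≤ q → 0ℚ ≤ p * q
*-nonNeg {p} {q} 0≤p 0≤q =
  nonNegative⁻¹ (p * q) {{nonNeg*nonNeg⇒nonNeg p {{nonNegative 0≤p}} q {{nonNegative 0≤q}}}}

unitSign : ∀ t → ∃ λ s → s * s ≡ 1ℚ × 0ℚ ≤ s * t
unitSign t with 0ℚ ≤? t
... | yes 0≤t = 1ℚ , refl , subst (0ℚ ≤_) (sym (*-identityˡ t)) 0≤t
... | no  0≰t = - 1ℚ , refl , subst (0ℚ ≤_) (sym (-1*x≈-x t)) (neg-antimono-≤ (<⇒≤ (≰⇒> 0≰t)))

nonzero-divides : ∀ {p} → p ≢ 0ℚ → ∀ q → ∃ λ r → q ≡ r * p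
nonzero-divides {p} p≢0 q = q * 1/ p , (begin
  q                ≡⟨ *-identityʳ q ⟨
  q * 1ℚ           ≡⟨ cong (q *_) (*-inverseˡ p) ⟨
  q * (1/ p * p)   ≡⟨ *-assoc q (1/ p) p ⟨
  q * 1/ p * p     ∎)
  where
  open ≡-Reasoning
  instance
    p≢0ᵢ : NonZero p
    p≢0ᵢ = ≢-nonZero p≢0

¬¬-∀-Fin : ∀ {p} {P : Fin n → Set p} → (∀ i → ¬ ¬ P i) → ¬ ¬ (∀ i → P i)
¬¬-∀-Fin {n = zero}  _   ¬∀P = ¬∀P λ ()
¬¬-∀-Fin {n = suc n} ¬¬P ¬∀P =
  ¬¬P zero λ P₀ → ¬¬-∀-Fin (¬¬P ∘ suc) λ P₊ → ¬∀P (∀-cons P₀ P₊)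

e : Fin d → Pt d
e x y with x Fin.≟ y
... | yes _ = 1ℚ
... | no  _ = 0ℚ

e-diag : (x : Fin d) → e x x ≡ 1ℚ
e-diag x with x Fin.≟ x
... | yes _   = refl
... | no  x≢x = ⊥-elim (x≢x refl)

e-off : {x y : Fin d} → x ≢ y → e x y ≡ 0ℚ
e-off {x = x} {y} x≢y with x Fin.≟ y
... | yes x≡y = ⊥-elim (x≢y x≡y)
... | no  _   = refl

dot : Pt d → Pt d → ℚ
dot w v = sum (λ y → w y * v y)

module _ (w : Pt d) where
  open ≡-Reasoning

  dot-cong : ∀ {u v} → u ≈ v → dot w u ≡ dot w v
  dot-cong {u} {v} u≈v =
    sum-cong-≗ {x = λ y → w y * u y} {y = λ y → w y * v y} (λ y → cong (w y *_) (u≈v y))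

  dot-zero : dot w zeroPt ≡ 0ℚ
  dot-zero = sum-*-zeros w zeroPt (λ _ → refl)

  dot-⊕ : ∀ u v → dot w (u ⊕ v) ≡ dot w u + dot w v
  dot-⊕ u v = begin
    sum (λ y → w y * (u y + v y))       ≡⟨ sum-cong-≗ (λ y → *-distribˡ-+ (w y) (u y) (v y)) ⟩
    sum (λ y → w y * u y + w y * v y)   ≡⟨ ∑-distrib-+ (λ y → w y * u y) (λ y → w y * v y) ⟩
    dot w u + dot w v                   ∎

  dot-⊙ : ∀ c v → dot w (c ⊙ v) ≡ c * dot w v
  dot-⊙ c v = begin
    sum (λ y → w y * (c * v y))   ≡⟨ sum-cong-≗ (λ y → x∙yz≈y∙xz (w y) c (v y)) ⟩
    sum (λ y → c * (w y * v y))   ≡⟨ *-distribˡ-sum c (λ y → w y * v y) ⟨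
    c * dot w v                   ∎

  dot-neg : ∀ v → dot w (negPt v) ≡ - dot w v
  dot-neg v = begin
    dot w (negPt v)       ≡⟨ dot-cong (λ y → sym (-1*x≈-x (v y))) ⟩
    dot w ((- 1ℚ) ⊙ v)    ≡⟨ dot-⊙ (- 1ℚ) v ⟩
    - 1ℚ * dot w v        ≡⟨ -1*x≈-x (dot w v) ⟩
    - dot w v             ∎

  dot-single : (x : Fin d) {v : Pt d} → (∀ y → y ≢ x → w y * v y ≡ 0ℚ) → dot w v ≡ w x * v x
  dot-single x = sum-vanishing-off +-0-commutativeMonoid _ x

  dot-e : (x : Fin d) → dot w (e x) ≡ w x
  dot-e x = begin
    dot w (e x)   ≡⟨ dot-single x off ⟩
    w x * e x x   ≡⟨ cong (w x *_) (e-diag x) ⟩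
    w x * 1ℚ      ≡⟨ *-identityʳ (w x) ⟩
    w x           ∎
    where
    off : ∀ y → y ≢ x → w y * e x y ≡ 0ℚ
    off y y≢x = trans (cong (w y *_) (e-off (y≢x ∘ sym))) (*-zeroʳ (w y))

dot-comm : (w v : Pt d) → dot w v ≡ dot v w
dot-comm w v = sum-cong-≗ {x = λ y → w y * v y} (λ y → *-comm (w y) (v y))

dot-⊙e : ∀ c (x : Fin d) v → dot (c ⊙ e x) v ≡ c * v x
dot-⊙e c x v = trans (dot-comm (c ⊙ e x) v) (trans (dot-⊙ v c (e x)) (cong (c *_) (dot-e v x)))

NonNegOn : PtSet d → Pt d → Set
NonNegOn R w = ∀ r → R r → 0ℚ ≤ dot w r

module _ {R : PtSet d} (w : Pt d) (w≥0 : NonNegOn R w) where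

  pos-nonNeg : ∀ {v} → pos R v → 0ℚ ≤ dot w v
  pos-nonNeg (cs , cs∈R , cs≈v) = subst (0ℚ ≤_) (dot-cong w cs≈v) (lincomb-nonNeg cs cs∈R)
    where
    lincomb-nonNeg : ∀ cs → All (λ ca → (0ℚ ≤ proj₁ ca) × R (proj₂ ca)) cs →
                     0ℚ ≤ dot w (lincomb cs)
    lincomb-nonNeg []             []                   = ≤-reflexive (sym (dot-zero w))
    lincomb-nonNeg ((c , a) ∷ cs) ((0≤c , a∈R) ∷ cs∈R) = subst (0ℚ ≤_) (sym dot-cons)
      (+-mono-≤ (*-nonNeg 0≤c (w≥0 a a∈R)) (lincomb-nonNeg cs cs∈R))
      where
      dot-cons : dot w ((c ⊙ a) ⊕ lincomb cs) ≡ c * dot w a + dot w (lincomb cs)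
      dot-cons = trans (dot-⊕ w (c ⊙ a) (lincomb cs)) (cong (_+ dot w (lincomb cs)) (dot-⊙ w c a))

  lpos-orthogonal : ∀ {v} → lpos R v → dot w v ≡ 0ℚ
  lpos-orthogonal {v} (v∈pos , -v∈pos) = ≤-antisym w·v≤0 (pos-nonNeg v∈pos)
    where
    w·v≤0 : dot w v ≤ 0ℚ
    w·v≤0 = subst (_≤ 0ℚ) (-‿involutive (dot w v))
              (neg-antimono-≤ (subst (0ℚ ≤_) (dot-neg w v) (pos-nonNeg -v∈pos)))

  lpos-coord≡0 : (x : Fin d) → w x * w x ≡ 1ℚ → ∀ {v} → (∀ y → y ≢ x → w y * v y ≡ 0ℚ) →
                 lpos R v → v x ≡ 0ℚ
  lpos-coord≡0 x wx²≡1 {v} off v∈lpos = begin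
    v x                 ≡⟨ *-identityˡ (v x) ⟨
    1ℚ * v x            ≡⟨ cong (_* v x) wx²≡1 ⟨
    w x * w x * v x     ≡⟨ *-assoc (w x) (w x) (v x) ⟩
    w x * (w x * v x)   ≡⟨ cong (w x *_) (trans (sym (dot-single w x off)) (lpos-orthogonal v∈lpos)) ⟩
    w x * 0ℚ            ≡⟨ *-zeroʳ (w x) ⟩
    0ℚ                  ∎
    where open ≡-Reasoning

single-value⇒lpos-coord≡0 : {R : PtSet d} (x : Fin d) (t : ℚ) →
                            (∀ r → R r → r x ≡ 0ℚ ⊎ r x ≡ t) → ∀ {v} → lpos R v → v x ≡ 0ℚ
single-value⇒lpos-coord≡0 {R = R} x t values {v} v∈lpos with unitSign t
... | s , s²≡1 , 0≤st = lpos-coord≡0 (s ⊙ e x) nonNeg x unit off v∈lpos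
  where
  nonNeg : NonNegOn R (s ⊙ e x)
  nonNeg r r∈R = subst (0ℚ ≤_) (sym (dot-⊙e s x r))
    ([ (λ rx≡0 → ≤-reflexive (sym (trans (cong (s *_) rx≡0) (*-zeroʳ s))))
     , (λ rx≡t → subst (λ q → 0ℚ ≤ s * q) (sym rx≡t) 0≤st)
     ]′ (values r r∈R))
  unit : s * e x x * (s * e x x) ≡ 1ℚ
  unit = trans (cong (λ q → s * q * (s * q)) (e-diag x)) (trans (cong (λ q → q * q) (*-identityʳ s)) s²≡1)
  off : ∀ y → y ≢ x → s * e x y * v y ≡ 0ℚ
  off y y≢x = trans (cong (λ q → s * q * v y) (e-off (y≢x ∘ sym)))
                    (trans (cong (_* v y) (*-zeroʳ s)) (*-zeroˡ (v y)))

module _ {A : PtSet d} where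

  ∈⇒pos : ∀ {v} → A v → pos A v
  ∈⇒pos {v} v∈A =
    (1ℚ , v) ∷ [] , (nonNegative⁻¹ 1ℚ , v∈A) ∷ [] , λ y → trans (+-identityʳ _) (*-identityˡ (v y))

  lincomb-++ : (cs ds : List (ℚ × Pt d)) → lincomb (cs ++ ds) ≈ (lincomb cs ⊕ lincomb ds)
  lincomb-++ []             ds y = sym (+-identityˡ _)
  lincomb-++ ((c , a) ∷ cs) ds y =
    trans (cong (c * a y +_) (lincomb-++ cs ds y)) (sym (+-assoc (c * a y) (lincomb cs y) (lincomb ds y)))

  pos-⊕ : ∀ {u v} → pos A u → pos A v → pos A (u ⊕ v)
  pos-⊕ (cs , cs∈A , cs≈u) (ds , ds∈A , ds≈v) =
    cs ++ ds , All.++⁺ cs∈A ds∈A , λ y → trans (lincomb-++ cs ds y) (cong₂ _+_ (cs≈u y) (ds≈v y))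

  pos-resp-≈ : ∀ {u v} → u ≈ v → pos A u → pos A v
  pos-resp-≈ u≈v (cs , cs∈A , cs≈u) = cs , cs∈A , λ y → trans (cs≈u y) (u≈v y)

fsum-sum : (c : Fin m → ℚ) (u : Fin m → Pt d) (x : Fin d) → fsum c u x ≡ sum (λ j → c j * u j x)
fsum-sum {m = zero}  c u x = refl
fsum-sum {m = suc m} c u x = cong (c zero * u zero x +_) (fsum-sum (c ∘ suc) (u ∘ suc) x)

Dependent : (Fin m → Pt d) → Set
Dependent {m = m} u =
  Σ (Fin m → ℚ) λ c → (∃ λ j → c j ≢ 0ℚ) × (∀ x → sum (λ j → c j * u j x) ≡ 0ℚ)

Dependent⇒¬LinIndep : {u : Fin m → Pt d} → Dependent u → ¬ LinIndep u
Dependent⇒¬LinIndep {u = u} (c , (j , cj≢0) , vanish) indep =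
  cj≢0 (indep c (λ x → trans (fsum-sum c u x) (vanish x)) j)

e∘inj-LinIndep : (ι : Fin m → Fin d) → Injective _≡_ _≡_ ι → LinIndep (e ∘ ι)
e∘inj-LinIndep ι ι-inj c vanish j = begin
  c j                               ≡⟨ *-identityʳ (c j) ⟨
  c j * 1ℚ                          ≡⟨ cong (c j *_) (e-diag (ι j)) ⟨
  c j * e (ι j) (ι j)               ≡⟨ sum-vanishing-off +-0-commutativeMonoid _ j off ⟨
  sum (λ i → c i * e (ι i) (ι j))   ≡⟨ fsum-sum c (e ∘ ι) (ι j) ⟨
  fsum c (e ∘ ι) (ι j)              ≡⟨ vanish (ι j) ⟩
  0ℚ                                ∎
  where
  open ≡-Reasoning
  off : ∀ i → i ≢ j → c i * e (ι i) (ι j) ≡ 0ℚ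
  off i i≢j = trans (cong (c i *_) (e-off (i≢j ∘ ι-inj))) (*-zeroʳ (c i))

pivot : (a : Fin (suc n) → ℚ) →
        Σ (Fin (suc n)) λ p → Σ (Fin n → ℚ) λ λs → ∀ j → a (punchIn p j) ≡ λs j * a p
pivot a with all? (λ i → a i ≟ 0ℚ)
... | yes a≡0 = zero , (λ _ → 0ℚ) , λ j → trans (a≡0 (suc j)) (sym (*-zeroˡ (a zero)))
... | no  a≢0 with ¬∀⟶∃¬ _ (λ i → a i ≡ 0ℚ) (λ i → a i ≟ 0ℚ) a≢0
...   | p , ap≢0 = p , (λ j → proj₁ (divides j)) , (λ j → proj₂ (divides j))
  where
  divides : ∀ j → ∃ λ r → a (punchIn p j) ≡ r * a p
  divides j = nonzero-divides ap≢0 (a (punchIn p j))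

reduce : (u : Fin (suc m) → Pt d) (p : Fin (suc m)) (λs : Fin m → ℚ) → Fin m → Pt d
reduce u p λs j x = u (punchIn p j) x + - (λs j * u p x)

private
  move-product : ∀ l q a → - l * q + a ≡ a + l * - q
  move-product = solve-∀ ℚ-ring

  factor-coefficient : ∀ c a l q → c * a + c * l * - q ≡ c * (a + - (l * q))
  factor-coefficient = solve-∀ ℚ-ring

combination-reduce : (u : Fin (suc m) → Pt d) (p : Fin (suc m)) (λs c : Fin m → ℚ) (x : Fin d) →
  sum (λ j → insertAt c p (- sum (λ j → c j * λs j)) j * u j x) ≡
  sum (λ j → c j * reduce u p λs j x)
combination-reduce u p λs c x = begin
  sum (λ j → c′ j * u j x)
    ≡⟨ sum-remove {i = p} (λ j → c′ j * u j x) ⟩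
  c′ p * u p x + sum (λ j → c′ (punchIn p j) * u (punchIn p j) x)
    ≡⟨ cong₂ _+_ (cong (_* u p x) (insertAt-lookup c p (- L)))
                 (sum-cong-≗ (λ j → cong (_* u (punchIn p j) x) (insertAt-punchIn c p (- L) j))) ⟩
  - L * u p x + A
    ≡⟨ move-product L (u p x) A ⟩
  A + L * - u p x
    ≡⟨ cong (A +_) (*-distribʳ-sum (- u p x) (λ j → c j * λs j)) ⟩
  A + sum (λ j → c j * λs j * - u p x)
    ≡⟨ ∑-distrib-+ (λ j → c j * u (punchIn p j) x) (λ j → c j * λs j * - u p x) ⟨
  sum (λ j → c j * u (punchIn p j) x + c j * λs j * - u p x)
    ≡⟨ sum-cong-≗ (λ j → factor-coefficient (c j) (u (punchIn p j) x) (λs j) (u p x)) ⟩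
  sum (λ j → c j * reduce u p λs j x) ∎
  where
  open ≡-Reasoning
  L = sum (λ j → c j * λs j)
  A = sum (λ j → c j * u (punchIn p j) x)
  c′ = insertAt c p (- L)

1+n-vectors-Dependent : ∀ n (u : Fin (suc n) → Pt n) → Dependent u
1+n-vectors-Dependent zero    u = (λ _ → 1ℚ) , (zero , 1≢0) , λ ()
1+n-vectors-Dependent (suc n) u with pivot (λ j → u j zero)
... | p , λs , column≡ with 1+n-vectors-Dependent n (λ j x → reduce u p λs j (suc x))
...   | c , (j₀ , cj₀≢0) , vanish =
  insertAt c p (- sum (λ j → c j * λs j)) ,
  (punchIn p j₀ , subst (_≢ 0ℚ) (sym (insertAt-punchIn c p _ j₀)) cj₀≢0) ,
  λ x → trans (combination-reduce u p λs c x) (reduced-vanish x)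
  where
  reduced-column : ∀ j → reduce u p λs j zero ≡ 0ℚ
  reduced-column j = trans (cong (_+ - (λs j * u p zero)) (column≡ j)) (+-inverseʳ (λs j * u p zero))
  reduced-vanish : ∀ x → sum (λ j → c j * reduce u p λs j x) ≡ 0ℚ
  reduced-vanish zero    = sum-*-zeros c (λ j → reduce u p λs j zero) reduced-column
  reduced-vanish (suc x) = vanish x

supportedOn⇒Dependent : (g : Fin n → Fin d) (u : Fin (suc n) → Pt d) →
                        (∀ y → (∃ λ i → g i ≡ y) ⊎ (∀ j → u j y ≡ 0ℚ)) → Dependent u
supportedOn⇒Dependent {n = n} g u covered with 1+n-vectors-Dependent n (λ j i → u j (g i))
... | c , nontrivial , vanish =
  c , nontrivial , λ y → [ (λ { (i , refl) → vanish i }) , sum-*-zeros c (λ j → u j y) ]′ (covered y)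

module Construction (k m : ℕ) where

  base : Fin (suc k) → Fin (suc k ℕ.+ m)
  base b = b ↑ˡ m

  lift : Fin m → Fin (suc k ℕ.+ m)
  lift p = suc k ↑ʳ p

  data CoordView : Fin (suc k ℕ.+ m) → Set where
    is-base : ∀ b → CoordView (base b)
    is-lift : ∀ p → CoordView (lift p)

  coordView : ∀ y → CoordView y
  coordView y with splitAt (suc k) y in eq
  ... | inj₁ b = subst CoordView (splitAt⁻¹-↑ˡ eq) (is-base b)
  ... | inj₂ p = subst CoordView (splitAt⁻¹-↑ʳ eq) (is-lift p)

  base≢lift : ∀ b p → base b ≢ lift p
  base≢lift b p eq
    with trans (sym (splitAt-↑ˡ (suc k) b m)) (trans (cong (splitAt (suc k)) eq) (splitAt-↑ʳ (suc k) m p))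
  ... | ()

  Dir : Set
  Dir = Fin (suc k) ⊎ Fin (suc k)

  axis : Dir → Fin (suc k)
  axis = [ id , id ]′

  sgn : Dir → ℚ
  sgn (inj₁ _) = 1ℚ
  sgn (inj₂ _) = - 1ℚ

  dirVec : Dir → Pt (suc k ℕ.+ m)
  dirVec D = sgn D ⊙ e (base (axis D))

  sgn²≡1 : ∀ D → sgn D * sgn D ≡ 1ℚ
  sgn²≡1 (inj₁ _) = refl
  sgn²≡1 (inj₂ _) = refl

  sgn≢0 : ∀ D → sgn D ≢ 0ℚ
  sgn≢0 (inj₁ _) ()
  sgn≢0 (inj₂ _) ()

  axis-sgn-injective : ∀ {D D′} → axis D ≡ axis D′ → sgn D ≡ sgn D′ → D ≡ D′
  axis-sgn-injective {inj₁ _} {inj₁ _} refl _  = refl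
  axis-sgn-injective {inj₂ _} {inj₂ _} refl _  = refl
  axis-sgn-injective {inj₁ _} {inj₂ _} _    ()
  axis-sgn-injective {inj₂ _} {inj₁ _} _    ()

  sgn-opposite : ∀ {D D′} → D ≢ D′ → axis D ≡ axis D′ → sgn D * sgn D′ ≡ - 1ℚ
  sgn-opposite {inj₁ _} {inj₁ _} D≢D′ refl = ⊥-elim (D≢D′ refl)
  sgn-opposite {inj₁ _} {inj₂ _} _    _    = refl
  sgn-opposite {inj₂ _} {inj₁ _} _    _    = refl
  sgn-opposite {inj₂ _} {inj₂ _} D≢D′ refl = ⊥-elim (D≢D′ refl)

  dirVec-on-axis : ∀ D → dirVec D (base (axis D)) ≡ sgn D
  dirVec-on-axis D = trans (cong (sgn D *_) (e-diag (base (axis D)))) (*-identityʳ (sgn D))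

  dirVec-off-axis : ∀ D {b} → axis D ≢ b → dirVec D (base b) ≡ 0ℚ
  dirVec-off-axis D a≢b = trans (cong (sgn D *_) (e-off (a≢b ∘ ↑ˡ-injective m _ _))) (*-zeroʳ (sgn D))

  dirVec-injective : ∀ {D D′} → dirVec D ≡ dirVec D′ → D ≡ D′
  dirVec-injective {D} {D′} eq = compare (axis D′ Fin.≟ axis D)
    where
    sgnD≡ : sgn D ≡ dirVec D′ (base (axis D))
    sgnD≡ = trans (sym (dirVec-on-axis D)) (cong-app eq (base (axis D)))
    compare : Dec (axis D′ ≡ axis D) → D ≡ D′
    compare (no  a′≢a) = ⊥-elim (sgn≢0 D (trans sgnD≡ (dirVec-off-axis D′ a′≢a)))
    compare (yes a′≡a) = axis-sgn-injective (sym a′≡a)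
      (trans sgnD≡ (subst (λ b → dirVec D′ (base b) ≡ sgn D′) a′≡a (dirVec-on-axis D′)))

  Cross : PtSet (suc k ℕ.+ m)
  Cross v = ∃ λ D → v ≡ dirVec D

  Lifted : Fin m → PtSet (suc k ℕ.+ m)
  Lifted p v = v ≡ negPt (e (lift p)) ⊎ ∃ λ D → v ≡ e (lift p) ⊕ dirVec D

  dirVec-lift : ∀ D p → dirVec D (lift p) ≡ 0ℚ
  dirVec-lift D p = trans (cong (sgn D *_) (e-off (base≢lift (axis D) p))) (*-zeroʳ (sgn D))

  Lifted-off : ∀ {q p r} → q ≢ p → Lifted q r → r (lift p) ≡ 0ℚ
  Lifted-off q≢p (inj₁ refl)       = cong -_ (e-off (q≢p ∘ ↑ʳ-injective (suc k) _ _))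
  Lifted-off q≢p (inj₂ (D , refl)) =
    cong₂ _+_ (e-off (q≢p ∘ ↑ʳ-injective (suc k) _ _)) (dirVec-lift D _)

  Role : Set
  Role = Fin (suc k ℕ.+ k) ⊎ Fin m

  setOf : Role → PtSet (suc k ℕ.+ m)
  setOf (inj₁ _) = Cross
  setOf (inj₂ p) = Lifted p

  private
    add-cancel : ∀ a x → a + x + - a ≡ x
    add-cancel = solve-∀ ℚ-ring

  dirVec∈pos : ∀ ρ D → pos (setOf ρ) (dirVec D)
  dirVec∈pos (inj₁ _) D = ∈⇒pos (D , refl)
  dirVec∈pos (inj₂ p) D =
    pos-resp-≈ (λ y → add-cancel (e (lift p) y) (dirVec D y))
      (pos-⊕ (∈⇒pos (inj₂ (D , refl))) (∈⇒pos (inj₁ refl)))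

  e-base∈lpos : ∀ ρ b → lpos (setOf ρ) (e (base b))
  e-base∈lpos ρ b = pos-resp-≈ (λ y → *-identityˡ _) (dirVec∈pos ρ (inj₁ b))
                  , pos-resp-≈ (λ y → -1*x≈-x _) (dirVec∈pos ρ (inj₂ b))

  setOf-lpos-DimGt : ∀ ρ → DimGt (lpos (setOf ρ)) k
  setOf-lpos-DimGt ρ = e ∘ base , e-base∈lpos ρ , e∘inj-LinIndep base (↑ˡ-injective m _ _)

  private
    cross-cancel : ∀ s s′ x → s * (0ℚ + s′ * x) + s′ * (- s * x) ≡ 0ℚ
    cross-cancel = solve-∀ ℚ-ring

    neg-sign-product : ∀ s s′ → s′ * (- s * 1ℚ) ≡ - (s′ * s)
    neg-sign-product = solve-∀ ℚ-ring

    neg-square : ∀ s → - s * 1ℚ * (- s * 1ℚ) ≡ s * s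
    neg-square = solve-∀ ℚ-ring

  module Rainbow {N} (role : Fin N ↔ Role) (f : Fin N → Maybe (Pt (suc k ℕ.+ m)))
                 (valid : ValidChoice (setOf ∘ Inverse.to role) f) where
    open Inverse role using (to; from; strictlyInverseʳ)

    R : PtSet (suc k ℕ.+ m)
    R = selSet f

    picked : Role → Maybe (Pt (suc k ℕ.+ m))
    picked = f ∘ from

    pickedAt : Role → Fin (suc k ℕ.+ m) → ℚ
    pickedAt ρ y = maybe (λ r → r y) 0ℚ (picked ρ)

    pickedAt-just : ∀ {ρ r} y → picked ρ ≡ just r → pickedAt ρ y ≡ r y
    pickedAt-just y = cong (maybe (λ r → r y) 0ℚ)

    selected : ∀ {r} → R r → Σ Role λ ρ → picked ρ ≡ just r × setOf ρ r
    selected (i , fi≡r) = to i , trans (cong f (strictlyInverseʳ i)) fi≡r , valid i _ fi≡r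

    lift-values : ∀ p r → R r → r (lift p) ≡ 0ℚ ⊎ r (lift p) ≡ pickedAt (inj₂ p) (lift p)
    lift-values p r r∈R with selected r∈R
    ... | inj₁ _ , _ , (D , refl) = inj₁ (dirVec-lift D p)
    ... | inj₂ q , picked≡r , r∈Lifted with q Fin.≟ p
    ...   | yes refl = inj₂ (sym (pickedAt-just (lift p) picked≡r))
    ...   | no  q≢p  = inj₁ (Lifted-off q≢p r∈Lifted)

    lift-coord≡0 : ∀ p {v} → lpos R v → v (lift p) ≡ 0ℚ
    lift-coord≡0 p = single-value⇒lpos-coord≡0 (lift p) _ (lift-values p)

    Picked : Dir → Set
    Picked D = ∃ λ s → picked (inj₁ s) ≡ just (dirVec D)

    module Missed (D : Dir) (¬picked : ¬ Picked D) where

      a : Fin (suc k ℕ.+ m)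
      a = base (axis D)

      σ : ℚ
      σ = sgn D

      -- On lift coordinate p, w cancels the a-component of the point picked from Lifted p, so
      -- w is orthogonal to that point; the only point of Cross on which w is negative is dirVec D.
      wBase : Fin (suc k) → ℚ
      wBase b = - σ * e (base b) a

      wLift : Fin m → ℚ
      wLift p = σ * pickedAt (inj₂ p) a

      w : Pt (suc k ℕ.+ m)
      w = wBase Vector.++ wLift

      dot-w-dirVec : ∀ D′ → dot w (dirVec D′) ≡ sgn D′ * (- σ * e (base (axis D′)) a)
      dot-w-dirVec D′ = trans (dot-⊙ w (sgn D′) (e (base (axis D′))))
        (cong (sgn D′ *_) (trans (dot-e w (base (axis D′))) (lookup-++ˡ wBase wLift (axis D′))))

      dot-w-e-lift : ∀ p → dot w (e (lift p)) ≡ σ * pickedAt (inj₂ p) a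
      dot-w-e-lift p = trans (dot-e w (lift p)) (lookup-++ʳ wBase wLift p)

      e-lift-a : ∀ p → e (lift p) a ≡ 0ℚ
      e-lift-a p = e-off (base≢lift (axis D) p ∘ sym)

      other-dirVec-nonNeg : ∀ D′ → D′ ≢ D → 0ℚ ≤ dot w (dirVec D′)
      other-dirVec-nonNeg D′ D′≢D with axis D′ Fin.≟ axis D
      ... | yes same = subst (0ℚ ≤_) (sym (begin
              dot w (dirVec D′)                   ≡⟨ dot-w-dirVec D′ ⟩
              σ′ * (- σ * e (base (axis D′)) a)   ≡⟨ cong (λ b → σ′ * (- σ * e (base b) a)) same ⟩
              σ′ * (- σ * e a a)                  ≡⟨ cong (λ x → σ′ * (- σ * x)) (e-diag a) ⟩
              σ′ * (- σ * 1ℚ)                     ≡⟨ neg-sign-product σ σ′ ⟩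
              - (σ′ * σ)                          ≡⟨ cong -_ (sgn-opposite D′≢D same) ⟩
              1ℚ                                  ∎)) (nonNegative⁻¹ 1ℚ)
        where
        open ≡-Reasoning
        σ′ = sgn D′
      ... | no  differ = ≤-reflexive (sym (begin
              dot w (dirVec D′)                   ≡⟨ dot-w-dirVec D′ ⟩
              σ′ * (- σ * e (base (axis D′)) a)   ≡⟨ cong (λ x → σ′ * (- σ * x)) E≡0 ⟩
              σ′ * (- σ * 0ℚ)                     ≡⟨ cong (σ′ *_) (*-zeroʳ (- σ)) ⟩
              σ′ * 0ℚ                             ≡⟨ *-zeroʳ σ′ ⟩
              0ℚ                                  ∎))
        where
        open ≡-Reasoning
        σ′ = sgn D′
        E≡0 = e-off (differ ∘ ↑ˡ-injective m _ _)

      w-nonNeg : NonNegOn R w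
      w-nonNeg r r∈R with selected r∈R
      ... | inj₁ s , picked≡r , (D′ , refl) =
        other-dirVec-nonNeg D′ λ { refl → ¬picked (s , picked≡r) }
      ... | inj₂ p , picked≡r , inj₁ refl = ≤-reflexive (sym (begin
              dot w (negPt (e (lift p)))    ≡⟨ dot-neg w (e (lift p)) ⟩
              - dot w (e (lift p))          ≡⟨ cong -_ (dot-w-e-lift p) ⟩
              - (σ * pickedAt (inj₂ p) a)   ≡⟨ cong (λ x → - (σ * x)) (pickedAt-just a picked≡r) ⟩
              - (σ * - e (lift p) a)        ≡⟨ cong (λ x → - (σ * - x)) (e-lift-a p) ⟩
              - (σ * - 0ℚ)                  ≡⟨ cong -_ (*-zeroʳ σ) ⟩
              0ℚ                            ∎))
        where open ≡-Reasoning
      ... | inj₂ p , picked≡r , inj₂ (D′ , refl) = ≤-reflexive (sym (begin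
              dot w (e (lift p) ⊕ dirVec D′)
                ≡⟨ dot-⊕ w (e (lift p)) (dirVec D′) ⟩
              dot w (e (lift p)) + dot w (dirVec D′)
                ≡⟨ cong₂ _+_ (dot-w-e-lift p) (dot-w-dirVec D′) ⟩
              σ * pickedAt (inj₂ p) a + σ′ * (- σ * E)
                ≡⟨ cong (λ x → σ * x + σ′ * (- σ * E)) (pickedAt-just a picked≡r) ⟩
              σ * (e (lift p) a + σ′ * E) + σ′ * (- σ * E)
                ≡⟨ cong (λ x → σ * (x + σ′ * E) + σ′ * (- σ * E)) (e-lift-a p) ⟩
              σ * (0ℚ + σ′ * E) + σ′ * (- σ * E)
                ≡⟨ cross-cancel σ σ′ E ⟩
              0ℚ ∎))
        where
        open ≡-Reasoning
        σ′ = sgn D′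
        E = e (base (axis D′)) a

      axis-coord≡0 : ∀ {v} → lpos R v → v a ≡ 0ℚ
      axis-coord≡0 {v} v∈lpos = lpos-coord≡0 w w-nonNeg a unit off v∈lpos
        where
        wa≡-σ : w a ≡ - σ * 1ℚ
        wa≡-σ = trans (lookup-++ˡ wBase wLift (axis D)) (cong (- σ *_) (e-diag a))
        unit : w a * w a ≡ 1ℚ
        unit = trans (cong (λ x → x * x) wa≡-σ) (trans (neg-square σ) (sgn²≡1 D))
        off : ∀ y → y ≢ a → w y * v y ≡ 0ℚ
        off y y≢a with coordView y
        ... | is-base b = trans (cong (_* v (base b)) wb≡0) (*-zeroˡ (v (base b)))
          where
          wb≡0 : w (base b) ≡ 0ℚ
          wb≡0 = trans (lookup-++ˡ wBase wLift b) (trans (cong (- σ *_) (e-off y≢a)) (*-zeroʳ (- σ)))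
        ... | is-lift p =
          trans (cong (w (lift p) *_) (lift-coord≡0 p v∈lpos)) (*-zeroʳ (w (lift p)))

    ¬all-picked : ¬ (∀ i → Picked (splitAt (suc k) i))
    ¬all-picked all-picked = <⇒notInjective (ℕ.+-monoʳ-< (suc k) (ℕ.n<1+n k)) source-injective
      where
      splitAt-injective : ∀ {i j} → splitAt (suc k) {suc k} i ≡ splitAt (suc k) j → i ≡ j
      splitAt-injective {i} {j} eq = trans (sym (join-splitAt (suc k) (suc k) i))
        (trans (cong (Fin.join (suc k) (suc k)) eq) (join-splitAt (suc k) (suc k) j))
      source-injective : Injective _≡_ _≡_ (proj₁ ∘ all-picked)
      source-injective {i} {j} same = splitAt-injective (dirVec-injective (just-injective (begin
        just (dirVec (splitAt (suc k) i))      ≡⟨ proj₂ (all-picked i) ⟨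
        picked (inj₁ (proj₁ (all-picked i)))   ≡⟨ cong (picked ∘ inj₁) same ⟩
        picked (inj₁ (proj₁ (all-picked j)))   ≡⟨ proj₂ (all-picked j) ⟩
        just (dirVec (splitAt (suc k) j))      ∎)))
        where open ≡-Reasoning

    -- Picked D is not decidable (it compares points of ℚᵈ as functions), so a missed direction
    -- is only obtained under double negation, which suffices for the contradiction.
    lpos-DimLe : DimLe (lpos R) k
    lpos-DimLe (u , u∈lpos , indep) = ¬¬-∀-Fin (¬¬picked ∘ splitAt (suc k)) ¬all-picked
      where
      ¬¬picked : ∀ D → ¬ ¬ Picked D
      ¬¬picked D ¬picked =
        Dependent⇒¬LinIndep {u = u} (supportedOn⇒Dependent (base ∘ punchIn (axis D)) u covered) indep
        where
        open Missed D ¬picked using (axis-coord≡0)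
        covered : ∀ y → (∃ λ i → base (punchIn (axis D) i) ≡ y) ⊎ (∀ j → u j y ≡ 0ℚ)
        covered y with coordView y
        ... | is-lift p = inj₂ (λ j → lift-coord≡0 p (u∈lpos j))
        ... | is-base b with axis D Fin.≟ b
        ...   | yes refl = inj₂ (λ j → axis-coord≡0 (u∈lpos j))
        ...   | no  a≢b  = inj₁ (punchOut a≢b , cong base (punchIn-punchOut a≢b))

corollary5p2 : (d k : ℕ) → 2 ℕ.≤ d → 1 ℕ.≤ k → k ℕ.< d →
    Σ (Fin (d ℕ.+ k) → PtSet d) λ A →
    ((i : Fin (d ℕ.+ k)) → DimGt (lpos (A i)) k)
    × ((f : Fin (d ℕ.+ k) → Maybe (Pt d)) → ValidChoice A f → DimLe (lpos (selSet f)) k)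
corollary5p2 d k _ _ k<d with ℕ.m≤n⇒∃[o]m+o≡n k<d
... | m , refl = setOf ∘ to , setOf-lpos-DimGt ∘ to , Rainbow.lpos-DimLe role
  where
  open Construction k m
  role : Fin (suc k ℕ.+ m ℕ.+ k) ↔ Role
  role = subst (λ N → Fin N ↔ Role) (xy∙z≈xz∙y (suc k) k m) +↔⊎
  open Inverse role using (to)
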